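{- Let $A\in I(k,l)$, let $P$ be an $A$-SSYT and $x$ a letter, and consider the $A$-RSK insertion of $x$ into $P$. Suppose that at some intermediate step the current tableau $\widetilde P$ is an $A$-SSYT, in which the entry $\widetilde P_{i,j}$ of cell $c(i,j)$ has just bumped the letter $y=P_{i,j}$ from $c(i,j)$, with $\widetilde P_{i,j}<_A y$, and that $y$ is now to be inserted: (a) into row $i+1$ of $\widetilde P$ if $y=t_r$ is a $t$-letter; (b) into column $j+1$ of $\widetilde P$ if $y=u_s$ is a $u$-letter. Then the resulting tableau $P^*$ is an $A$-SSYT, and if (not at the last step) $y$ in turn bumps an entry from a cell $c(i',j')$ of $P^*$, then: (1) if $y=t_r$, then $i'=i+1$ and $j'\le j$; (2) if $y=u_s$, then $j'=j+1$ and $i'\le i$.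
   Context: Let $t_1,\dots,t_k,u_1,\dots,u_l$ be distinct symbols ("$t$-letters" and "$u$-letters"). A shuffle is a total order $<_A$ with $t_1<_A\cdots<_A t_k$ and $u_1<_A\cdots<_A u_l$; $I(k,l)$ is the set of shuffles. $c(i,j)$ is the cell in row $i$, column $j$ (English convention). An $A$-SSYT is a tableau whose entries weakly $<_A$-increase along rows and down columns, with no $t$-letter repeated in a column and no $u$-letter repeated in a row. $A$-RSK insertion of a letter $x$ proceeds in steps: initially $x$ is inserted into row 1 if a $t$-letter, into column 1 if a $u$-letter. Inserting a $t$-letter $y$ into row $r$: $y$ bumps the leftmost entry of row $r$ strictly $A$-greater than $y$, or if none, is placed in a new cell at the end of row $r$. Inserting a $u$-letter $y$ into column $c$: $y$ bumps the topmost entry of column $c$ strictly $A$-greater than $y$, or if none, is placed in a new cell at the bottom of column $c$. An entry bumped from $c(i,j)$ is next inserted into row $i+1$ if a $t$-letter, into column $j+1$ if a $u$-letter; insertion ends when a new cell is created. -}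

module Defs where

open import Data.Nat using (ℕ; zero; suc; _<_; _≤_; _<?_)
open import Data.Fin using (Fin)
import Data.Fin as F
open import Data.List using (List; []; _∷_; length; _++_; [_])
open import Data.Maybe using (Maybe; just; nothing)
open import Data.Product using (_×_; _,_; proj₁; proj₂)
open import Relation.Nullary using (yes; no)
open import Relation.Binary.PropositionalEquality using (_≡_; _≢_)
open import Data.Empty using (⊥)

-- Letters: t-letters t a (a : Fin k) stand for t_{a+1}; u-letters u b (b : Fin l) for u_{b+1}.
data Letter (k l : ℕ) : Set where
  t : Fin k → Letter k l
  u : Fin l → Letter k l

-- A shuffle A ∈ I(k,l): a total order on the letters, encoded by an injective
-- rank function, with t_1 <_A ... <_A t_k and u_1 <_A ... <_A u_l.
record Shuffle (k l : ℕ) : Set where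
  field
    pos           : Letter k l → ℕ
    pos-injective : ∀ x y → pos x ≡ pos y → x ≡ y
    t-increasing  : ∀ a b → a F.< b → pos (t a) < pos (t b)
    u-increasing  : ∀ a b → a F.< b → pos (u a) < pos (u b)
open Shuffle public

module _ {k l : ℕ} (A : Shuffle k l) where
  _<A_ : Letter k l → Letter k l → Set
  x <A y = pos A x < pos A y

  _≤A_ : Letter k l → Letter k l → Set
  x ≤A y = pos A x ≤ pos A y

-- A tableau is the list of its rows (top to bottom, English convention).
-- Rows and columns are indexed from 0: cell c(i,j) of the paper is (i-1, j-1) here.
Tableau : ℕ → ℕ → Set
Tableau k l = List (List (Letter k l))

at : ∀ {X : Set} → List X → ℕ → Maybe X
at [] _ = nothing
at (x ∷ xs) zero = just x
at (x ∷ xs) (suc n) = at xs n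

cell : ∀ {k l} → Tableau k l → ℕ → ℕ → Maybe (Letter k l)
cell T i j with at T i
... | nothing = nothing
... | just row = at row j

setAt : ∀ {X : Set} → List X → ℕ → X → List X
setAt [] _ _ = []
setAt (x ∷ xs) zero y = y ∷ xs
setAt (x ∷ xs) (suc n) y = x ∷ setAt xs n y

data IsShape {X : Set} : List (List X) → Set where
  nil  : IsShape []
  one  : ∀ {x xs} → IsShape ((x ∷ xs) ∷ [])
  cons : ∀ {r s rs} → length s ≤ length r → IsShape (s ∷ rs) → IsShape (r ∷ s ∷ rs)

record IsSSYT {k l} (A : Shuffle k l) (T : Tableau k l) : Set where
  field
    shape    : IsShape T
    rowsWeak : ∀ i j j' x y → cell T i j ≡ just x → cell T i j' ≡ just y →
               j < j' → _≤A_ A x y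
    colsWeak : ∀ i i' j x y → cell T i j ≡ just x → cell T i' j ≡ just y →
               i < i' → _≤A_ A x y
    tColStrict : ∀ i i' j a → i ≢ i' → cell T i j ≡ just (t a) →
                 cell T i' j ≡ just (t a) → ⊥
    uRowStrict : ∀ i j j' b → j ≢ j' → cell T i j ≡ just (u b) →
                 cell T i j' ≡ just (u b) → ⊥

module Insertion {k l : ℕ} (A : Shuffle k l) where
  L = Letter k l
  T = Tableau k l

  mapIdx : ∀ {X : Set} → Maybe (ℕ × X) → Maybe (ℕ × X)
  mapIdx nothing = nothing
  mapIdx (just (n , x)) = just (suc n , x)

  rowIns : List L → L → List L × Maybe (ℕ × L)
  rowIns [] y = [ y ] , nothing
  rowIns (w ∷ ws) y with pos A y <? pos A w
  ... | yes _ = y ∷ ws , just (0 , w)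
  ... | no _  = w ∷ proj₁ (rowIns ws y) , mapIdx (proj₂ (rowIns ws y))

  -- insert y into row r of the tableau (r = number of rows: new row).
  -- Returns new tableau and possibly (column, bumped letter).
  rowInsT : T → ℕ → L → T × Maybe (ℕ × L)
  rowInsT [] zero y = [ y ] ∷ [] , nothing
  rowInsT [] (suc r) y = [] , nothing   -- unreachable (row index beyond the tableau)
  rowInsT (row ∷ rows) zero y = proj₁ (rowIns row y) ∷ rows , proj₂ (rowIns row y)
  rowInsT (row ∷ rows) (suc r) y = row ∷ proj₁ (rowInsT rows r y) , proj₂ (rowInsT rows r y)

  colIns : T → ℕ → L → T × Maybe (ℕ × L)
  colIns [] c y = [ y ] ∷ [] , nothing
  colIns (row ∷ rows) c y with at row c
  ... | nothing = (row ++ [ y ]) ∷ rows , nothing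
  ... | just w with pos A y <? pos A w
  ...   | yes _ = setAt row c y ∷ rows , just (0 , w)
  ...   | no _  = row ∷ proj₁ (colIns rows c y) , mapIdx (proj₂ (colIns rows c y))

  data State : Set where
    start   : T → L → State
    running : T → L → ℕ → ℕ → State  -- current tableau, letter y just bumped from cell (i , j)
    done    : T → State

  afterRow : ℕ → T × Maybe (ℕ × L) → State
  afterRow r (T' , nothing) = done T'
  afterRow r (T' , just (j , w)) = running T' w r j

  afterCol : ℕ → T × Maybe (ℕ × L) → State
  afterCol c (T' , nothing) = done T'
  afterCol c (T' , just (i , w)) = running T' w i c

  step : State → State
  step (start P (t a)) = afterRow 0 (rowInsT P 0 (t a))
  step (start P (u b)) = afterCol 0 (colIns P 0 (u b))
  step (running P (t a) i j) = afterRow (suc i) (rowInsT P (suc i) (t a))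
  step (running P (u b) i j) = afterCol (suc j) (colIns P (suc j) (u b))
  step (done P) = done P

  run : ℕ → State → State
  run zero s = s
  run (suc n) s = run n (step s)

  tableauOf : State → T
  tableauOf (start P _) = P
  tableauOf (running P _ _ _) = P
  tableauOf (done P) = P

module Submission where

-- The lemma is an invariant of A-RSK insertion. Whenever y has just been bumped from (i , j)
-- of Q, the tableau Q is an A-SSYT, the new entry at (i , j) is <A y, and the entry y meets
-- next (below (i , j) for a t-letter, right of it for a u-letter) is >A y. A t-letter y
-- inserted into row i+1 therefore lands in a column j' ≤ j; the entries above (i+1 , j') are
-- ≤A the entry now at (i , j), hence <A y, the entries left of it are ≤A y, and those right of
-- or below it are ≥A the bumped letter, hence >A y. These local conditions are exactly what
-- writing y at (i+1 , j') needs to keep an A-SSYT, and the bumped letter again satisfies the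
-- invariant. For u-letters exchange rows and columns.

open import Defs
open import Data.Nat using (ℕ; zero; suc; _≤_; _<_; _⊔_; z≤n; s≤s; _≟_; _≤?_; _<?_)
open import Data.Nat.Properties
open import Data.Fin using (Fin)
open import Data.Maybe using (Maybe; just; nothing)
open import Data.Maybe.Properties using (just-injective)
open import Data.Product using (_×_; ∃; _,_)
open import Data.Sum using (inj₁; inj₂)
open import Data.List using (List; []; _∷_; length; _++_; [_])
open import Data.Empty using (⊥; ⊥-elim)
open import Relation.Nullary using (¬_; yes; no; contradiction)
open import Relation.Binary using (tri<; tri≈; tri>)
open import Relation.Binary.PropositionalEquality hiding ([_])
open import Function using (_∘′_)

module _ {X : Set} where

  private variable
    m n : ℕ
    v w y : X

  at-just⇒< : (xs : List X) → at xs n ≡ just v → n < length xs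
  at-just⇒< {n = zero}  (x ∷ xs) _ = s≤s z≤n
  at-just⇒< {n = suc n} (x ∷ xs) e = s≤s (at-just⇒< xs e)

  <⇒at-just : (xs : List X) → n < length xs → ∃ λ v → at xs n ≡ just v
  <⇒at-just {n = zero}  (x ∷ xs) _         = x , refl
  <⇒at-just {n = suc n} (x ∷ xs) (s≤s n<) = <⇒at-just xs n<

  at-nothing⇒≤ : (xs : List X) → at xs n ≡ nothing → length xs ≤ n
  at-nothing⇒≤ {n = n}     []       _ = z≤n
  at-nothing⇒≤ {n = suc n} (x ∷ xs) e = s≤s (at-nothing⇒≤ xs e)

  -- For n ≥ length xs, y is appended at position length xs (not at n).
  put : List X → ℕ → X → List X
  put []       _       y = [ y ]
  put (x ∷ xs) zero    y = y ∷ xs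
  put (x ∷ xs) (suc n) y = x ∷ put xs n y

  at-put : (xs : List X) → n ≤ length xs → at (put xs n y) n ≡ just y
  at-put []       z≤n     = refl
  at-put {n = zero}  (x ∷ xs) _       = refl
  at-put {n = suc n} (x ∷ xs) (s≤s n≤) = at-put xs n≤

  at-put-≢ : (xs : List X) → n ≤ length xs → m ≢ n → at (put xs n y) m ≡ at xs m
  at-put-≢ {m = zero}  []       z≤n m≢n = contradiction refl m≢n
  at-put-≢ {m = suc m} []       z≤n _   = refl
  at-put-≢ {n = zero}  {zero}  (x ∷ xs) _ m≢n = contradiction refl m≢n
  at-put-≢ {n = zero}  {suc m} (x ∷ xs) _ _   = refl
  at-put-≢ {n = suc n} {zero}  (x ∷ xs) _ _   = refl
  at-put-≢ {n = suc n} {suc m} (x ∷ xs) (s≤s n≤) m≢n = at-put-≢ xs n≤ (m≢n ∘′ cong suc)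

  length-put : (xs : List X) → n ≤ length xs → length (put xs n y) ≡ length xs ⊔ suc n
  length-put []       z≤n      = refl
  length-put {n = zero}  (x ∷ xs) _        = cong suc (sym (⊔-identityʳ (length xs)))
  length-put {n = suc n} (x ∷ xs) (s≤s n≤) = cong suc (length-put xs n≤)

  put-length : (xs : List X) → put xs (length xs) y ≡ xs ++ [ y ]
  put-length []       = refl
  put-length (x ∷ xs) = cong (x ∷_) (put-length xs)

  put≡setAt : (xs : List X) → at xs n ≡ just w → put xs n y ≡ setAt xs n y
  put≡setAt {n = zero}  (x ∷ xs) _ = refl
  put≡setAt {n = suc n} (x ∷ xs) e = cong (x ∷_) (put≡setAt xs e)

module _ {k l : ℕ} where

  private variable
    Q : Tableau k l
    r : List (Letter k l)
    a b i j p q : ℕ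
    v w y : Letter k l

  rowLength : Tableau k l → ℕ → ℕ
  rowLength []       _       = 0
  rowLength (r ∷ Q) zero    = length r
  rowLength (r ∷ Q) (suc i) = rowLength Q i

  cell-just⇒< : ∀ Q → cell Q i j ≡ just v → j < rowLength Q i
  cell-just⇒< {i = zero}  (r ∷ Q) e = at-just⇒< r e
  cell-just⇒< {i = suc i} (r ∷ Q) e = cell-just⇒< Q e

  <⇒cell-just : ∀ Q → j < rowLength Q i → ∃ λ v → cell Q i j ≡ just v
  <⇒cell-just {i = zero}  (r ∷ Q) j< = <⇒at-just r j<
  <⇒cell-just {i = suc i} (r ∷ Q) j< = <⇒cell-just Q j<

  cell-just⇒row< : ∀ Q → cell Q i j ≡ just v → i < length Q
  cell-just⇒row< {i = zero}  (r ∷ Q) _ = s≤s z≤n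
  cell-just⇒row< {i = suc i} (r ∷ Q) e = s≤s (cell-just⇒row< Q e)

  RowPrefix : Tableau k l → ℕ → ℕ → (Letter k l → Set) → Set
  RowPrefix Q i j P = ∀ {b} → b < j → ∃ λ v → cell Q i b ≡ just v × P v

  ColPrefix : Tableau k l → ℕ → ℕ → (Letter k l → Set) → Set
  ColPrefix Q j i P = ∀ {a} → a < i → ∃ λ v → cell Q a j ≡ just v × P v

  RowPrefix⇒≤rowLength : ∀ {P} Q → RowPrefix Q i j P → j ≤ rowLength Q i
  RowPrefix⇒≤rowLength {j = zero}  Q _   = z≤n
  RowPrefix⇒≤rowLength {j = suc j} Q pre = let (_ , e , _) = pre (n<1+n j) in cell-just⇒< Q e

  RowPrefix-∷ : ∀ {P ws} → P w → RowPrefix [ ws ] 0 j P → RowPrefix [ w ∷ ws ] 0 (suc j) P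
  RowPrefix-∷ Pw _   {zero}  _         = _ , refl , Pw
  RowPrefix-∷ _  pre {suc b} (s≤s b<j) = pre b<j

  ColPrefix-∷ : ∀ {P} → at r j ≡ just w → P w → ColPrefix Q j i P → ColPrefix (r ∷ Q) j (suc i) P
  ColPrefix-∷ ew Pw _   {zero}  _         = _ , ew , Pw
  ColPrefix-∷ _  _  pre {suc a} (s≤s a<i) = pre a<i

  putCell : Tableau k l → ℕ → ℕ → Letter k l → Tableau k l
  putCell []      _       _ y = [ [ y ] ]
  putCell (r ∷ Q) zero    q y = put r q y ∷ Q
  putCell (r ∷ Q) (suc p) q y = r ∷ putCell Q p q y

  cell-putCell : ∀ Q → p ≤ length Q → q ≤ rowLength Q p → cell (putCell Q p q y) p q ≡ just y
  cell-putCell []      z≤n z≤n = refl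
  cell-putCell {p = zero}  (r ∷ Q) _        q≤ = at-put r q≤
  cell-putCell {p = suc p} (r ∷ Q) (s≤s p≤) q≤ = cell-putCell Q p≤ q≤

  cell-putCell-≢ : ∀ Q → p ≤ length Q → q ≤ rowLength Q p → ¬ (a ≡ p × b ≡ q) →
                   cell (putCell Q p q y) a b ≡ cell Q a b
  cell-putCell-≢ {a = zero}  {zero}  []      z≤n z≤n ab≢ = contradiction (refl , refl) ab≢
  cell-putCell-≢ {a = zero}  {suc b} []      z≤n z≤n _   = refl
  cell-putCell-≢ {a = suc a}         []      z≤n z≤n _   = refl
  cell-putCell-≢ {p = zero}  {a = zero}  (r ∷ Q) _ q≤ ab≢ = at-put-≢ r q≤ (λ b≡ → ab≢ (refl , b≡))
  cell-putCell-≢ {p = zero}  {a = suc a} (r ∷ Q) _ _  _   = refl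
  cell-putCell-≢ {p = suc p} {a = zero}  (r ∷ Q) _ _  _   = refl
  cell-putCell-≢ {p = suc p} {a = suc a} (r ∷ Q) (s≤s p≤) q≤ ab≢ =
    cell-putCell-≢ Q p≤ q≤ (λ (a≡ , b≡) → ab≢ (cong suc a≡ , b≡))

  data PutCellEntry (Q : Tableau k l) (p q : ℕ) (y : Letter k l) : ℕ → ℕ → Letter k l → Set where
    placed : PutCellEntry Q p q y p q y
    kept   : ¬ (a ≡ p × b ≡ q) → cell Q a b ≡ just v → PutCellEntry Q p q y a b v

  putCell-entry : ∀ Q → p ≤ length Q → q ≤ rowLength Q p →
                  cell (putCell Q p q y) a b ≡ just v → PutCellEntry Q p q y a b v
  putCell-entry {p = p} {q} {a = a} {b} Q p≤ q≤ e with a ≟ p | b ≟ q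
  ... | yes refl | yes refl rewrite just-injective (trans (sym e) (cell-putCell Q p≤ q≤)) = placed
  ... | no a≢p   | _        = kept ab≢ (trans (sym (cell-putCell-≢ Q p≤ q≤ ab≢)) e)
    where ab≢ = λ (a≡ , _) → a≢p a≡
  ... | yes _    | no b≢q   = kept ab≢ (trans (sym (cell-putCell-≢ Q p≤ q≤ ab≢)) e)
    where ab≢ = λ (_ , b≡) → b≢q b≡

  rowLength-suc≤ : IsShape Q → ∀ i → rowLength Q (suc i) ≤ rowLength Q i
  rowLength-suc≤ nil          _       = z≤n
  rowLength-suc≤ one          _       = z≤n
  rowLength-suc≤ (cons le _)  zero    = le
  rowLength-suc≤ (cons _ sh)  (suc i) = rowLength-suc≤ sh i

  rowLength-antitone : IsShape Q → a ≤ i → rowLength Q i ≤ rowLength Q a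
  rowLength-antitone sh a≤i with m≤n⇒m<n∨m≡n a≤i
  ... | inj₂ refl = ≤-refl
  ... | inj₁ (s≤s a≤i′) = ≤-trans (rowLength-suc≤ sh _) (rowLength-antitone sh a≤i′)

  putCell-shape : IsShape Q → p ≤ length Q → q ≤ rowLength Q p →
                  (∀ {a} → a < p → q < rowLength Q a) → IsShape (putCell Q p q y)
  putCell-shape nil z≤n z≤n _ = one
  putCell-shape {p = zero}  {zero}  one _ _ _ = one
  putCell-shape {p = zero}  {suc q} one _ _ _ = one
  putCell-shape {p = suc zero} {zero} one _ _ _ = cons (s≤s z≤n) one
  putCell-shape {p = suc (suc _)} one (s≤s ()) _ _
  putCell-shape {p = zero} (cons {r} le sh) _ q≤ _ =
    cons (≤-trans le (subst (length r ≤_) (sym (length-put r q≤)) (m≤m⊔n _ _))) sh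
  putCell-shape {p = suc zero} (cons {s = s} le sh) _ q≤ above =
    cons (subst (_≤ _) (sym (length-put s q≤)) (⊔-lub le (above (s≤s z≤n))))
         (putCell-shape sh z≤n q≤ λ ())
  putCell-shape {p = suc (suc p)} (cons le sh) (s≤s p≤) q≤ above =
    cons le (putCell-shape sh p≤ q≤ (above ∘′ s≤s))

module _ {k l : ℕ} (A : Shuffle k l) where

  private variable
    Q : Tableau k l
    a b i j p q : ℕ
    v w y z : Letter k l

  infix 4 _<ᴬ_ _≤ᴬ_ _⊑col_ _⊑row_

  _<ᴬ_ _≤ᴬ_ : Letter k l → Letter k l → Set
  _<ᴬ_ = _<A_ A
  _≤ᴬ_ = _≤A_ A

  -- x ⊑col y: x may lie above y in a column of an A-SSYT (strictly below y if y is a t-letter);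
  -- x ⊑row y: x may lie left of y in a row (strictly below y if y is a u-letter).
  _⊑col_ : Letter k l → Letter k l → Set
  x ⊑col t r = x <ᴬ t r
  x ⊑col u s = x ≤ᴬ u s

  _⊑row_ : Letter k l → Letter k l → Set
  x ⊑row t r = x ≤ᴬ t r
  x ⊑row u s = x <ᴬ u s

  ⊑col⇒≤ᴬ : ∀ y → v ⊑col y → v ≤ᴬ y
  ⊑col⇒≤ᴬ (t _) = <⇒≤
  ⊑col⇒≤ᴬ (u _) v≤y = v≤y

  ⊑row⇒≤ᴬ : ∀ y → v ⊑row y → v ≤ᴬ y
  ⊑row⇒≤ᴬ (t _) v≤y = v≤y
  ⊑row⇒≤ᴬ (u _) = <⇒≤

  ≤ᴬ∧≢⇒<ᴬ : v ≤ᴬ w → v ≢ w → v <ᴬ w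
  ≤ᴬ∧≢⇒<ᴬ {v} {w} v≤w v≢w = ≤∧≢⇒< v≤w (v≢w ∘′ pos-injective A v w)

  module _ (ss : IsSSYT A Q) where
    open IsSSYT ss

    rowsWeak-≤ : b ≤ j → cell Q i b ≡ just v → cell Q i j ≡ just w → v ≤ᴬ w
    rowsWeak-≤ b≤j ev ew with m≤n⇒m<n∨m≡n b≤j
    ... | inj₁ b<j = rowsWeak _ _ _ _ _ ev ew b<j
    ... | inj₂ refl rewrite just-injective (trans (sym ev) ew) = ≤-refl

    colsWeak-≤ : a ≤ i → cell Q a j ≡ just v → cell Q i j ≡ just w → v ≤ᴬ w
    colsWeak-≤ a≤i ev ew with m≤n⇒m<n∨m≡n a≤i
    ... | inj₁ a<i = colsWeak _ _ _ _ _ ev ew a<i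
    ... | inj₂ refl rewrite just-injective (trans (sym ev) ew) = ≤-refl

    north-west-< : cell Q i j ≡ just z → z <ᴬ y → a ≤ i → b ≤ j →
                   ∃ λ v → cell Q a b ≡ just v × v <ᴬ y
    north-west-< ez z<y a≤i b≤j =
      let (m , em) = <⇒cell-just Q (≤-trans (cell-just⇒< Q ez) (rowLength-antitone shape a≤i))
          (v , ev) = <⇒cell-just Q (≤-<-trans b≤j (cell-just⇒< Q em))
      in v , ev , ≤-<-trans (≤-trans (rowsWeak-≤ b≤j ev em) (colsWeak-≤ a≤i em ez)) z<y

  record Fits (Q : Tableau k l) (p q : ℕ) (y : Letter k l) : Set where
    field
      above : ColPrefix Q q p (_⊑col y)
      left  : RowPrefix Q p q (_⊑row y)
      right : ∀ {b v} → q < b → cell Q p b ≡ just v → y <ᴬ v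
      below : ∀ {a v} → p < a → cell Q a q ≡ just v → y <ᴬ v

    above-≤ᴬ : a < p → cell Q a q ≡ just v → v ≤ᴬ y
    above-≤ᴬ a<p ev = let (v′ , ev′ , v′⊑y) = above a<p in
      subst (_≤ᴬ y) (just-injective (trans (sym ev′) ev)) (⊑col⇒≤ᴬ y v′⊑y)

    left-≤ᴬ : b < q → cell Q p b ≡ just v → v ≤ᴬ y
    left-≤ᴬ b<q ev = let (v′ , ev′ , v′⊑y) = left b<q in
      subst (_≤ᴬ y) (just-injective (trans (sym ev′) ev)) (⊑row⇒≤ᴬ y v′⊑y)

  fits-bump : IsSSYT A Q → cell Q p q ≡ just w → y <ᴬ w →
              ColPrefix Q q p (_⊑col y) → RowPrefix Q p q (_⊑row y) → Fits Q p q y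
  fits-bump ss ew y<w above left = record
    { above = above
    ; left  = left
    ; right = λ q<b ev → <-≤-trans y<w (IsSSYT.rowsWeak ss _ _ _ _ _ ew ev q<b)
    ; below = λ p<a ev → <-≤-trans y<w (IsSSYT.colsWeak ss _ _ _ _ _ ew ev p<a)
    }

  fits-end : IsShape Q → rowLength Q p ≤ q →
             ColPrefix Q q p (_⊑col y) → RowPrefix Q p q (_⊑row y) → Fits Q p q y
  fits-end {Q} sh end above left = record
    { above = above
    ; left  = left
    ; right = λ q<b ev → ⊥-elim (<-asym q<b (<-≤-trans (cell-just⇒< Q ev) end))
    ; below = λ p<a ev → ⊥-elim (<-irrefl refl
        (<-≤-trans (cell-just⇒< Q ev) (≤-trans (rowLength-antitone sh (<⇒≤ p<a)) end)))
    }

  Fits⇒t-unique : ∀ {r} → Fits Q p q (t r) → a ≢ p → cell Q a q ≢ just (t r)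
  Fits⇒t-unique {p = p} {a = a} fits a≢p ev with <-cmp a p
  ... | tri< a<p _ _ = let (v , ev′ , v<y) = Fits.above fits a<p in
    <-irrefl (cong (pos A) (just-injective (trans (sym ev′) ev))) v<y
  ... | tri≈ _ a≡p _ = a≢p a≡p
  ... | tri> _ _ p<a = <-irrefl refl (Fits.below fits p<a ev)

  Fits⇒u-unique : ∀ {s} → Fits Q p q (u s) → b ≢ q → cell Q p b ≢ just (u s)
  Fits⇒u-unique {q = q} {b = b} fits b≢q ev with <-cmp b q
  ... | tri< b<q _ _ = let (v , ev′ , v<y) = Fits.left fits b<q in
    <-irrefl (cong (pos A) (just-injective (trans (sym ev′) ev))) v<y
  ... | tri≈ _ b≡q _ = b≢q b≡q
  ... | tri> _ _ q<b = <-irrefl refl (Fits.right fits q<b ev)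

  putCell-SSYT : IsSSYT A Q → p ≤ length Q → q ≤ rowLength Q p → Fits Q p q y →
                 IsSSYT A (putCell Q p q y)
  putCell-SSYT {Q} {p} {q} {y} ss p≤ q≤ fits = record
    { shape      = putCell-shape shape p≤ q≤ λ a<p → let (_ , ev , _) = above a<p in
                                                     cell-just⇒< Q ev
    ; rowsWeak   = rowsWeak′
    ; colsWeak   = colsWeak′
    ; tColStrict = tColStrict′
    ; uRowStrict = uRowStrict′
    }
    where
    open IsSSYT ss
    open Fits fits
    R = putCell Q p q y
    entry : ∀ {a b v} → cell R a b ≡ just v → PutCellEntry Q p q y a b v
    entry = putCell-entry Q p≤ q≤

    rowsWeak′ : ∀ i j j′ v w → cell R i j ≡ just v → cell R i j′ ≡ just w → j < j′ → v ≤ᴬ w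
    rowsWeak′ i j j′ v w ev ew j<j′ with entry ev | entry ew
    ... | placed     | placed      = ⊥-elim (<-irrefl refl j<j′)
    ... | placed     | kept _ ew′  = <⇒≤ (right j<j′ ew′)
    ... | kept _ ev′ | placed      = left-≤ᴬ j<j′ ev′
    ... | kept _ ev′ | kept _ ew′  = rowsWeak i j j′ v w ev′ ew′ j<j′

    colsWeak′ : ∀ i i′ j v w → cell R i j ≡ just v → cell R i′ j ≡ just w → i < i′ → v ≤ᴬ w
    colsWeak′ i i′ j v w ev ew i<i′ with entry ev | entry ew
    ... | placed     | placed      = ⊥-elim (<-irrefl refl i<i′)
    ... | placed     | kept _ ew′  = <⇒≤ (below i<i′ ew′)
    ... | kept _ ev′ | placed      = above-≤ᴬ i<i′ ev′
    ... | kept _ ev′ | kept _ ew′  = colsWeak i i′ j v w ev′ ew′ i<i′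

    tColStrict′ : ∀ i i′ j r → i ≢ i′ → cell R i j ≡ just (t r) → cell R i′ j ≡ just (t r) → ⊥
    tColStrict′ i i′ j r i≢i′ ev ew with entry ev | entry ew
    ... | placed     | placed      = i≢i′ refl
    ... | placed     | kept _ ew′  = Fits⇒t-unique fits (i≢i′ ∘′ sym) ew′
    ... | kept _ ev′ | placed      = Fits⇒t-unique fits i≢i′ ev′
    ... | kept _ ev′ | kept _ ew′  = tColStrict i i′ j r i≢i′ ev′ ew′

    uRowStrict′ : ∀ i j j′ s → j ≢ j′ → cell R i j ≡ just (u s) → cell R i j′ ≡ just (u s) → ⊥
    uRowStrict′ i j j′ s j≢j′ ev ew with entry ev | entry ew
    ... | placed     | placed      = j≢j′ refl
    ... | placed     | kept _ ew′  = Fits⇒u-unique fits (j≢j′ ∘′ sym) ew′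
    ... | kept _ ev′ | placed      = Fits⇒u-unique fits j≢j′ ev′
    ... | kept _ ev′ | kept _ ew′  = uRowStrict i j j′ s j≢j′ ev′ ew′

  open Insertion A using (rowIns; rowInsT; colIns; State; start; running; done;
                          step; run; afterRow; afterCol; tableauOf)

  -- The row r is treated as the one-row tableau [ r ].
  data RowInsView (r : List (Letter k l)) (y : Letter k l) :
                  List (Letter k l) × Maybe (ℕ × Letter k l) → Set where
    bump   : at r j ≡ just w → y <ᴬ w → RowPrefix [ r ] 0 j (_≤ᴬ y) →
             RowInsView r y (put r j y , just (j , w))
    append : RowPrefix [ r ] 0 (length r) (_≤ᴬ y) → RowInsView r y (put r (length r) y , nothing)

  rowIns-view : ∀ r y → RowInsView r y (rowIns r y)
  rowIns-view []       y = append (λ ())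
  rowIns-view (w ∷ ws) y with pos A y <? pos A w
  ... | yes y<w = bump refl y<w (λ ())
  ... | no  y≮w with rowIns ws y | rowIns-view ws y
  ...   | _ | bump ew y<w pre = bump ew y<w (RowPrefix-∷ (≮⇒≥ y≮w) pre)
  ...   | _ | append pre      = append (RowPrefix-∷ (≮⇒≥ y≮w) pre)

  data RowInsTView (Q : Tableau k l) (i : ℕ) (y : Letter k l) :
                   Tableau k l × Maybe (ℕ × Letter k l) → Set where
    bump   : cell Q i j ≡ just w → y <ᴬ w → RowPrefix Q i j (_≤ᴬ y) →
             RowInsTView Q i y (putCell Q i j y , just (j , w))
    append : RowPrefix Q i (rowLength Q i) (_≤ᴬ y) →
             RowInsTView Q i y (putCell Q i (rowLength Q i) y , nothing)

  rowInsT-view : ∀ Q i y → i ≤ length Q → RowInsTView Q i y (rowInsT Q i y)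
  rowInsT-view []      zero    y _ = append (λ ())
  rowInsT-view (r ∷ Q) zero    y _ with rowIns r y | rowIns-view r y
  ... | _ | bump ew y<w pre = bump ew y<w pre
  ... | _ | append pre      = append pre
  rowInsT-view (r ∷ Q) (suc i) y (s≤s i≤) with rowInsT Q i y | rowInsT-view Q i y i≤
  ... | _ | bump ew y<w pre = bump ew y<w pre
  ... | _ | append pre      = append pre

  data ColInsView (Q : Tableau k l) (j : ℕ) (y : Letter k l) :
                  Tableau k l × Maybe (ℕ × Letter k l) → Set where
    bump   : cell Q i j ≡ just w → y <ᴬ w → ColPrefix Q j i (_≤ᴬ y) →
             ColInsView Q j y (putCell Q i j y , just (i , w))
    append : i ≤ length Q → rowLength Q i ≤ j → ColPrefix Q j i (_≤ᴬ y) →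
             ColInsView Q j y (putCell Q i (rowLength Q i) y , nothing)

  colIns-view : ∀ Q j y → ColInsView Q j y (colIns Q j y)
  colIns-view []      j y = append z≤n z≤n (λ ())
  colIns-view (r ∷ Q) j y with at r j in ej
  ... | nothing rewrite sym (put-length {y = y} r) = append z≤n (at-nothing⇒≤ r ej) (λ ())
  ... | just w with pos A y <? pos A w
  ...   | yes y<w rewrite sym (put≡setAt {y = y} r ej) = bump ej y<w (λ ())
  ...   | no  y≮w with colIns Q j y | colIns-view Q j y
  ...     | _ | bump ew y<w pre     = bump ew y<w (ColPrefix-∷ ej (≮⇒≥ y≮w) pre)
  ...     | _ | append i≤ end pre   = append (s≤s i≤) end (ColPrefix-∷ ej (≮⇒≥ y≮w) pre)

  RowPrefix-bound : ∀ Q i j → (∀ {v} → cell Q i j ≡ just v → y <ᴬ v) →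
                    RowPrefix Q i b (_≤ᴬ y) → b ≤ j
  RowPrefix-bound {b = b} Q i j exceeds pre with b ≤? j
  ... | yes b≤j = b≤j
  ... | no  b≰j = let (_ , ev , v≤y) = pre (≰⇒> b≰j) in contradiction (exceeds ev) (≤⇒≯ v≤y)

  ColPrefix-bound : ∀ Q i j → (∀ {v} → cell Q i j ≡ just v → y <ᴬ v) →
                    ColPrefix Q j a (_≤ᴬ y) → a ≤ i
  ColPrefix-bound {a = a} Q i j exceeds pre with a ≤? i
  ... | yes a≤i = a≤i
  ... | no  a≰i = let (_ , ev , v≤y) = pre (≰⇒> a≰i) in contradiction (exceeds ev) (≤⇒≯ v≤y)

  NextExceeds : Tableau k l → Letter k l → ℕ → ℕ → Set
  NextExceeds Q (t r) i j = ∀ {v} → cell Q (suc i) j ≡ just v → t r <ᴬ v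
  NextExceeds Q (u s) i j = ∀ {v} → cell Q i (suc j) ≡ just v → u s <ᴬ v

  IsSSYT⇒NextExceeds : IsSSYT A Q → cell Q i j ≡ just w → NextExceeds Q w i j
  IsSSYT⇒NextExceeds {w = t r} ss ew ev = ≤ᴬ∧≢⇒<ᴬ (IsSSYT.colsWeak ss _ _ _ _ _ ew ev (n<1+n _))
    λ r≡v → IsSSYT.tColStrict ss _ _ _ r (1+n≢n ∘′ sym) ew (trans ev (cong just (sym r≡v)))
  IsSSYT⇒NextExceeds {w = u s} ss ew ev = ≤ᴬ∧≢⇒<ᴬ (IsSSYT.rowsWeak ss _ _ _ _ _ ew ev (n<1+n _))
    λ s≡v → IsSSYT.uRowStrict ss _ _ _ s (1+n≢n ∘′ sym) ew (trans ev (cong just (sym s≡v)))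

  NextExceeds-putCell : ∀ Q → p ≤ length Q → q ≤ rowLength Q p →
                        NextExceeds Q w p q → NextExceeds (putCell Q p q y) w p q
  NextExceeds-putCell {w = t r} Q p≤ q≤ exceeds ev =
    exceeds (trans (sym (cell-putCell-≢ Q p≤ q≤ λ (p≡ , _) → 1+n≢n p≡)) ev)
  NextExceeds-putCell {w = u s} Q p≤ q≤ exceeds ev =
    exceeds (trans (sym (cell-putCell-≢ Q p≤ q≤ λ (_ , q≡) → 1+n≢n q≡)) ev)

  record Bumped (Q : Tableau k l) (y : Letter k l) (i j : ℕ) : Set where
    field
      ssyt     : IsSSYT A Q
      replaced : ∃ λ z → cell Q i j ≡ just z × z <ᴬ y
      next     : NextExceeds Q y i j

    row< : i < length Q
    row< = let (_ , ez , _) = replaced in cell-just⇒row< Q ez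

    north-west : a ≤ i → b ≤ j → ∃ λ v → cell Q a b ≡ just v × v <ᴬ y
    north-west = let (_ , ez , z<y) = replaced in north-west-< ssyt ez z<y

  Bumped⇒above< : ∀ {r} → Bumped Q (t r) i j → RowPrefix Q (suc i) b (_≤ᴬ t r) →
                  ColPrefix Q b (suc i) (_<ᴬ t r)
  Bumped⇒above< {Q} {i} {j} B left a<si =
    Bumped.north-west B (≤-pred a<si) (RowPrefix-bound Q (suc i) j (Bumped.next B) left)

  Bumped⇒left< : ∀ {s} → Bumped Q (u s) i j → ColPrefix Q (suc j) a (_≤ᴬ u s) →
                 RowPrefix Q a (suc j) (_<ᴬ u s)
  Bumped⇒left< {Q} {i} {j} B above b<sj =
    Bumped.north-west B (ColPrefix-bound Q i (suc j) (Bumped.next B) above) (≤-pred b<sj)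

  putCell-Bumped : IsSSYT A Q → p ≤ length Q → cell Q p q ≡ just w → y <ᴬ w → Fits Q p q y →
                   Bumped (putCell Q p q y) w p q
  putCell-Bumped {Q} ss p≤ ew y<w fits = record
    { ssyt     = putCell-SSYT ss p≤ q≤ fits
    ; replaced = _ , cell-putCell Q p≤ q≤ , y<w
    ; next     = NextExceeds-putCell Q p≤ q≤ (IsSSYT⇒NextExceeds ss ew)
    }
    where q≤ = <⇒≤ (cell-just⇒< Q ew)

  Invariant : State → Set
  Invariant (start P _)       = IsSSYT A P
  Invariant (running Q y i j) = Bumped Q y i j
  Invariant (done Q)          = IsSSYT A Q

  Invariant⇒IsSSYT : ∀ σ → Invariant σ → IsSSYT A (tableauOf σ)
  Invariant⇒IsSSYT (start _ _)       ss = ss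
  Invariant⇒IsSSYT (running _ _ _ _) B  = Bumped.ssyt B
  Invariant⇒IsSSYT (done _)          ss = ss

  rowInsT-Invariant : ∀ r → IsSSYT A Q → i ≤ length Q →
                      (∀ {j} → RowPrefix Q i j (_≤ᴬ t r) → ColPrefix Q j i (_<ᴬ t r)) →
                      Invariant (afterRow i (rowInsT Q i (t r)))
  rowInsT-Invariant {Q} {i} r ss i≤ above with rowInsT Q i (t r) | rowInsT-view Q i (t r) i≤
  ... | _ | bump ew y<w left =
    putCell-Bumped ss i≤ ew y<w (fits-bump ss ew y<w (above left) left)
  ... | _ | append left =
    putCell-SSYT ss i≤ ≤-refl (fits-end (IsSSYT.shape ss) ≤-refl (above left) left)

  colIns-Invariant : ∀ s → IsSSYT A Q →
                     (∀ {i} → ColPrefix Q j i (_≤ᴬ u s) → RowPrefix Q i j (_<ᴬ u s)) →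
                     Invariant (afterCol j (colIns Q j (u s)))
  colIns-Invariant {Q} {j} s ss left with colIns Q j (u s) | colIns-view Q j (u s)
  ... | _ | bump ew y<w above =
    putCell-Bumped ss (<⇒≤ (cell-just⇒row< Q ew)) ew y<w (fits-bump ss ew y<w above (left above))
  -- The cells left of column j in row i all exist, so the appended cell is (i , j).
  ... | _ | append i≤ end above rewrite ≤-antisym end (RowPrefix⇒≤rowLength Q (left above)) =
    putCell-SSYT ss i≤ (RowPrefix⇒≤rowLength Q (left above))
      (fits-end (IsSSYT.shape ss) end above (left above))

  step-Invariant : ∀ σ → Invariant σ → Invariant (step σ)
  step-Invariant (start P (t r))       ss = rowInsT-Invariant r ss z≤n (λ _ ())
  step-Invariant (start P (u s))       ss = colIns-Invariant s ss (λ _ ())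
  step-Invariant (running Q (t r) i j) B  =
    rowInsT-Invariant r (Bumped.ssyt B) (Bumped.row< B) (Bumped⇒above< B)
  step-Invariant (running Q (u s) i j) B  = colIns-Invariant s (Bumped.ssyt B) (Bumped⇒left< B)
  step-Invariant (done Q)              ss = ss

  run-Invariant : ∀ n σ → Invariant σ → Invariant (run n σ)
  run-Invariant zero    σ inv = inv
  run-Invariant (suc n) σ inv = run-Invariant n (step σ) (step-Invariant σ inv)

  rowInsT-lands : i ≤ length Q → ∀ {P* y′ i′ j′} →
                  afterRow i (rowInsT Q i y) ≡ running P* y′ i′ j′ →
                  i′ ≡ i × RowPrefix Q i j′ (_≤ᴬ y)
  rowInsT-lands {i = i} {Q = Q} {y = y} i≤ with rowInsT Q i y | rowInsT-view Q i y i≤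
  ... | _ | bump _ _ left = λ { refl → refl , left }
  ... | _ | append _      = λ ()

  colIns-lands : ∀ Q j → ∀ {P* y′ i′ j′} →
                 afterCol j (colIns Q j y) ≡ running P* y′ i′ j′ →
                 j′ ≡ j × ColPrefix Q j i′ (_≤ᴬ y)
  colIns-lands {y = y} Q j with colIns Q j y | colIns-view Q j y
  ... | _ | bump _ _ above = λ { refl → refl , above }
  ... | _ | append _ _ _   = λ ()

  running-step-bounds : Bumped Q y i j → ∀ {P* y′ i′ j′} →
                        step (running Q y i j) ≡ running P* y′ i′ j′ →
                        (∀ r → y ≡ t r → i′ ≡ suc i × j′ ≤ j) ×
                        (∀ s → y ≡ u s → j′ ≡ suc j × i′ ≤ i)
  running-step-bounds {Q} {t r} {i} {j} B e =
    let (i′≡ , left) = rowInsT-lands (Bumped.row< B) e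
    in (λ _ _ → i′≡ , RowPrefix-bound Q (suc i) j (Bumped.next B) left) , λ _ ()
  running-step-bounds {Q} {u s} {i} {j} B e =
    let (j′≡ , above) = colIns-lands Q (suc j) e
    in (λ _ ()) , λ _ _ → j′≡ , ColPrefix-bound Q i (suc j) (Bumped.next B) above

lemma2p3 : ∀ {k l} (A : Shuffle k l) (P : Tableau k l) (x : Letter k l) (n : ℕ)
             (P̃ : Tableau k l) (y : Letter k l) (i j : ℕ) →
             IsSSYT A P →
             Insertion.run A n (Insertion.start P x) ≡ Insertion.running P̃ y i j →
             IsSSYT A P̃ →
             (∃ λ z → cell P̃ i j ≡ just z × _<A_ A z y) →
             cell P i j ≡ just y →
             IsSSYT A (Insertion.tableauOf A (Insertion.step A (Insertion.running P̃ y i j)))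
             × (∀ P* y' i' j' →
                  Insertion.step A (Insertion.running P̃ y i j) ≡ Insertion.running P* y' i' j' →
                  (∀ (r : Fin k) → y ≡ t r → i' ≡ suc i × j' ≤ j)
                  × (∀ (s : Fin l) → y ≡ u s → j' ≡ suc j × i' ≤ i))
-- The invariant along the run already provides the properties of P̃.
lemma2p3 A P x n P̃ y i j ssP run≡ _ _ _ =
  Invariant⇒IsSSYT A _ (step-Invariant A _ bumped) , λ _ _ _ _ → running-step-bounds A bumped
  where
  bumped : Bumped A P̃ y i j
  bumped = subst (Invariant A) run≡ (run-Invariant A n (Insertion.start P x) ssP)
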